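{- Let $p\geq 1$ and $n\geq 1$ be integers. For every $i\in[1,n]$, the number of edges of $\Gamma_n^p$ that use the direction $i$ is $$|E_i|=F_i^pF_{n-i+1}^p.$$
   Context: For $p\geq 1$, a Fibonacci $p$-string of length $n$ is a binary string of length $n$ in which any two 1s are separated by at least $p$ 0s. The Fibonacci $p$-cube $\Gamma_n^p$ is the subgraph of the hypercube $Q_n$ (vertex set $\{0,1\}^n$, adjacency = differing in exactly one coordinate) induced by the Fibonacci $p$-strings of length $n$. An edge $uv$ uses direction $i$ if $u$ and $v$ differ in coordinate $i$; $E_i$ is the set of edges of $\Gamma_n^p$ using direction $i$. The Fibonacci $p$-numbers are defined by $F_0^p=0$, $F_i^p=1$ for $i\in[1,p]$, and $F_n^p=F_{n-1}^p+F_{n-p-1}^p$ for $n\geq p+1$. -}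

module Defs where

open import Data.Nat using (ℕ; zero; suc; _+_; _∸_; _≤_; _<_; _≤?_)
open import Data.Bool using (Bool; true; false)
open import Data.Fin using (Fin; toℕ)
open import Data.Vec using (Vec; lookup; allFin; toList)
open import Data.List using (List; []; _∷_; filter; length; cartesianProduct)
open import Data.Product using (_×_; _,_; proj₁; proj₂)
open import Relation.Binary.PropositionalEquality using (_≡_; _≢_)
open import Relation.Nullary using (¬_; Dec; yes; no)
open import Data.Fin.Properties using (all?)

-- Fibonacci p-numbers (paper's definition):
--   F 0 = 0,  F i = 1 for i ∈ [1,p],  F n = F (n-1) + F (n-p-1) for n ≥ p+1.
-- Implemented with a fuel argument (fuel ≥ n suffices; we use fuel = n).

fibFuel : ℕ → ℕ → ℕ → ℕ
fibFuel fuel    p zero = 0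
fibFuel zero    p (suc n) = 0   -- unreachable when fuel ≥ index
fibFuel (suc f) p (suc n) with suc n ≤? p
... | yes _ = 1
... | no  _ = fibFuel f p n + fibFuel f p (n ∸ p)

Fib : ℕ → ℕ → ℕ
Fib p n = fibFuel n p n

-- Binary strings of length n, as Vec Bool n (coordinates indexed by Fin n,
-- coordinate i ∈ [1,n] of the paper is index i-1).

IsFibString : ∀ {n} → ℕ → Vec Bool n → Set
IsFibString {n} p u =
  (i j : Fin n) → lookup u i ≡ true → lookup u j ≡ true →
  toℕ i < toℕ j → suc (toℕ i + p) ≤ toℕ j

DiffersExactlyAt : ∀ {n} → Fin n → Vec Bool n → Vec Bool n → Set
DiffersExactlyAt {n} i u v =
  (lookup u i ≢ lookup v i) × ((k : Fin n) → k ≢ i → lookup u k ≡ lookup v k)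

allStrings : (n : ℕ) → List (Vec Bool n)
allStrings zero = Data.Vec.[] ∷ []
allStrings (suc n) = go (allStrings n)
  where
  go : List (Vec Bool n) → List (Vec Bool (suc n))
  go [] = []
  go (x ∷ xs) = (false Data.Vec.∷ x) ∷ (true Data.Vec.∷ x) ∷ go xs

-- Edges of Γ_n^p using direction i.  Each (undirected) edge {u,v} is
-- represented exactly once, as the ordered pair (u , v) with u_i = 0, v_i = 1.
IsEdgeInDir : ∀ {n} → ℕ → Fin n → Vec Bool n × Vec Bool n → Set
IsEdgeInDir p i (u , v) =
  IsFibString p u × IsFibString p v × DiffersExactlyAt i u v ×
  lookup u i ≡ false

isFibString? : ∀ {n} (p : ℕ) (u : Vec Bool n) → Dec (IsFibString p u)
isFibString? {n} p u =
  all? λ i → all? λ j →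
    (lookup u i Data.Bool.Properties.≟ true) →-dec
      (((lookup u j Data.Bool.Properties.≟ true)) →-dec
        ((toℕ i <? toℕ j) →-dec (suc (toℕ i + p) ≤? toℕ j)))
  where
  open import Relation.Nullary.Decidable using (_→-dec_)
  open import Data.Nat using (_<?_)
  import Data.Bool.Properties

differsExactlyAt? : ∀ {n} (i : Fin n) (u v : Vec Bool n) → Dec (DiffersExactlyAt i u v)
differsExactlyAt? {n} i u v =
  (¬? (lookup u i Data.Bool.Properties.≟ lookup v i)) ×-dec
  (all? λ k → (¬? (k Data.Fin.≟ i)) →-dec (lookup u k Data.Bool.Properties.≟ lookup v k))
  where
  open import Relation.Nullary.Decidable using (_→-dec_; _×-dec_; ¬?)
  import Data.Bool.Properties
  import Data.Fin

isEdgeInDir? : ∀ {n} (p : ℕ) (i : Fin n) (e : Vec Bool n × Vec Bool n) → Dec (IsEdgeInDir p i e)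
isEdgeInDir? p i (u , v) =
  isFibString? p u ×-dec (isFibString? p v ×-dec
    (differsExactlyAt? i u v ×-dec (lookup u i Data.Bool.Properties.≟ false)))
  where
  open import Relation.Nullary.Decidable using (_×-dec_)
  import Data.Bool.Properties

EdgeCount : ∀ {n} (p : ℕ) (i : Fin n) → ℕ
EdgeCount {n} p i =
  length (filter (isEdgeInDir? p i) (cartesianProduct (allStrings n) (allStrings n)))

{-# OPTIONS --safe #-}
-- An edge in direction k is determined by its upper end v, a Fibonacci string with a 1 at k:
-- its lower end v[k := 0] is automatically a Fibonacci string, since removing a 1 keeps the
-- 1s apart. Reading strings from the left with an automaton whose state counts the zeros still
-- owed after the last 1, the strings with a 1 at k split into the admissible prefixes before k
-- (counted by F_{k+1}) and the admissible suffixes after k (counted by F_{n-k}).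
module Submission where

open import Defs
open import Data.Nat using (ℕ; suc; _+_; _∸_; _*_; _≤_)
open import Data.Fin using (Fin; toℕ)
open import Relation.Binary.PropositionalEquality using (_≡_)

open import Level using (Level)
open import Function using (_∘_; const; _⇔_; mk⇔; Equivalence)
open import Data.Bool using (Bool; true; false; not; _∧_; T)
open import Data.Bool.Properties using (∧-zeroʳ; ¬-not) renaming (_≟_ to _≟ᵇ_)
open import Data.Unit using (tt)
open import Data.Product using (_×_; _,_; proj₁; proj₂)
open import Data.Nat using (zero; z≤n; s≤s; _<_; _≤?_)
open import Data.Nat.Properties
  using (≤-refl; ≤-trans; ≤-pred; <⇒≤; <⇒≱; ≮⇒≥; m∸n≤m; m≤n⇒m∸n≡0; n∸n≡0; 0∸n≡0; m+n∸n≡m;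
         +-assoc; +-comm; +-identityʳ; *-identityˡ; *-distribʳ-+; +-commutativeSemigroup)
open import Algebra.Properties.CommutativeSemigroup +-commutativeSemigroup using (interchange)
open import Data.Fin using (zero; suc) renaming (_≟_ to _≟ᶠ_)
open import Data.List using (List; []; _∷_; _++_; map; length; filter; cartesianProduct)
open import Data.List.Properties using (map-++; map-cong; map-∘)
open import Data.Nat.ListAction using (sum)
open import Data.Nat.ListAction.Properties using (sum-++)
open import Data.Vec using (Vec; []; _∷_; lookup; _[_]≔_)
open import Data.Vec.Properties
  using (≡-dec; lookup∘updateAt; lookup∘updateAt′; tabulate∘lookup; tabulate-cong)
open import Relation.Binary.PropositionalEquality using (refl; sym; trans; cong; cong₂; subst; module ≡-Reasoning)
open import Relation.Nullary using (Dec; yes; no; does; contradiction)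
open import Relation.Nullary.Decidable using (_×-dec_; T?; does-⇔)

private
  variable
    a ℓ : Level
    A B : Set a
    m n c p : ℕ

indicator : Bool → ℕ
indicator false = 0
indicator true  = 1

count : (A → Bool) → List A → ℕ
count f xs = sum (map (indicator ∘ f) xs)

length-filter≡count : {P : A → Set ℓ} (P? : ∀ x → Dec (P x)) (xs : List A) →
  length (filter P? xs) ≡ count (does ∘ P?) xs
length-filter≡count P? []       = refl
length-filter≡count P? (x ∷ xs) with does (P? x)
... | true  = cong suc (length-filter≡count P? xs)
... | false = length-filter≡count P? xs

count-cong : {f g : A → Bool} → (∀ x → f x ≡ g x) → ∀ xs → count f xs ≡ count g xs
count-cong f≗g xs = cong sum (map-cong (cong indicator ∘ f≗g) xs)

count-false : (xs : List A) → count (const false) xs ≡ 0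
count-false []       = refl
count-false (x ∷ xs) = count-false xs

count-++ : ∀ (f : A → Bool) xs ys → count f (xs ++ ys) ≡ count f xs + count f ys
count-++ f xs ys = trans (cong sum (map-++ (indicator ∘ f) xs ys)) (sum-++ (map (indicator ∘ f) xs) _)

count-map : (f : B → Bool) (h : A → B) (xs : List A) → count f (map h xs) ≡ count (f ∘ h) xs
count-map f h xs = cong sum (sym (map-∘ xs))

count-cartesianProduct : (f : A × B → Bool) (xs : List A) (ys : List B) →
  count f (cartesianProduct xs ys) ≡ sum (map (λ x → count (f ∘ (x ,_)) ys) xs)
count-cartesianProduct f []       ys = refl
count-cartesianProduct f (x ∷ xs) ys = begin
  count f (map (x ,_) ys ++ cartesianProduct xs ys)        ≡⟨ count-++ f (map (x ,_) ys) _ ⟩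
  count f (map (x ,_) ys) + count f (cartesianProduct xs ys) ≡⟨ cong₂ _+_ (count-map f (x ,_) ys) (count-cartesianProduct f xs ys) ⟩
  count (f ∘ (x ,_)) ys + sum (map (λ x → count (f ∘ (x ,_)) ys) xs) ∎
  where open ≡-Reasoning

private
  mutual
    -- Names the where-bound helper of `allStrings`, which is not in scope, by letting unification solve it.
    prependBoth : ∀ n → List (Vec Bool n) → List (Vec Bool (suc n))
    prependBoth = _

    allStrings-suc : ∀ n → allStrings (suc n) ≡ prependBoth n (allStrings n)
    allStrings-suc n with allStrings n
    ... | strings = refl

countStrings : ∀ n → (Vec Bool n → Bool) → ℕ
countStrings n f = count f (allStrings n)

countStrings-suc : ∀ n (f : Vec Bool (suc n) → Bool) →
  countStrings (suc n) f ≡ countStrings n (f ∘ (false ∷_)) + countStrings n (f ∘ (true ∷_))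
countStrings-suc n f = trans (cong (count f) (allStrings-suc n)) (count-prependBoth (allStrings n))
  where
  count-prependBoth : ∀ xs → count f (prependBoth n xs) ≡ count (f ∘ (false ∷_)) xs + count (f ∘ (true ∷_)) xs
  count-prependBoth []       = refl
  count-prependBoth (x ∷ xs) = begin
    x₀ + (x₁ + count f (prependBoth n xs))                             ≡⟨ cong (λ r → x₀ + (x₁ + r)) (count-prependBoth xs) ⟩
    x₀ + (x₁ + (count (f ∘ (false ∷_)) xs + count (f ∘ (true ∷_)) xs)) ≡⟨ sym (+-assoc x₀ x₁ _) ⟩
    (x₀ + x₁) + (count (f ∘ (false ∷_)) xs + count (f ∘ (true ∷_)) xs) ≡⟨ interchange x₀ x₁ _ _ ⟩
    (x₀ + count (f ∘ (false ∷_)) xs) + (x₁ + count (f ∘ (true ∷_)) xs) ∎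
    where
    open ≡-Reasoning
    x₀ = indicator (f (false ∷ x))
    x₁ = indicator (f (true ∷ x))

countStrings-cong : {f g : Vec Bool n → Bool} → (∀ v → f v ≡ g v) → countStrings n f ≡ countStrings n g
countStrings-cong {n} f≗g = count-cong f≗g (allStrings n)

countStrings-false : ∀ n → countStrings n (const false) ≡ 0
countStrings-false n = count-false (allStrings n)

_≟ᵛ_ : (u v : Vec Bool n) → Dec (u ≡ v)
_≟ᵛ_ = ≡-dec _≟ᵇ_

countStrings-≟ : (w : Vec Bool n) → countStrings n (λ v → does (v ≟ᵛ w)) ≡ 1
countStrings-≟ []            = refl
countStrings-≟ {suc n} (false ∷ w) = trans (countStrings-suc n _) (cong₂ _+_ (countStrings-≟ w) (countStrings-false n))
countStrings-≟ {suc n} (true ∷ w)  = trans (countStrings-suc n _) (cong₂ _+_ (countStrings-false n) (countStrings-≟ w))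

countStrings-∧-≟ : (b : Bool) (w : Vec Bool n) → countStrings n (λ v → b ∧ does (v ≟ᵛ w)) ≡ indicator b
countStrings-∧-≟ {n} false w = countStrings-false n
countStrings-∧-≟     true  w = countStrings-≟ w

fibFuel-irrelevant : ∀ f g p m → m ≤ f → m ≤ g → fibFuel f p m ≡ fibFuel g p m
fibFuel-irrelevant f       g       p zero    _         _         = refl
fibFuel-irrelevant (suc f) (suc g) p (suc m) (s≤s m≤f) (s≤s m≤g) with suc m ≤? p
... | yes _ = refl
... | no  _ = cong₂ _+_ (fibFuel-irrelevant f g p m m≤f m≤g)
                        (fibFuel-irrelevant f g p (m ∸ p) (≤-trans (m∸n≤m m p) m≤f) (≤-trans (m∸n≤m m p) m≤g))

Fib-one : 1 ≤ m → m ≤ p → Fib p m ≡ 1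
Fib-one {suc m} {p} _ m≤p with suc m ≤? p
... | yes _   = refl
... | no  m≰p = contradiction m≤p m≰p

-- Valid for every m ≥ 1, not just m ≥ p: for m < p the second summand is F₀ = 0 by truncated subtraction.
Fib-suc : 1 ≤ m → Fib p (suc m) ≡ Fib p m + Fib p (m ∸ p)
Fib-suc {suc m} {p} 1≤m with suc (suc m) ≤? p
... | yes m<p = sym (cong₂ _+_ (Fib-one 1≤m (<⇒≤ m<p)) (cong (Fib p) (m≤n⇒m∸n≡0 (<⇒≤ m<p))))
... | no  _   = cong (Fib p (suc m) +_) (fibFuel-irrelevant (suc m) (suc m ∸ p) p (suc m ∸ p) (m∸n≤m (suc m) p) ≤-refl)

LeadingZeros : ℕ → Vec Bool n → Set
LeadingZeros c v = ∀ i → toℕ i < c → lookup v i ≡ false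

leadingZeros-≤ : {v : Vec Bool n} → LeadingZeros c v → ∀ {j} → lookup v j ≡ true → c ≤ toℕ j
leadingZeros-≤ zeros {j} vj≡1 = ≮⇒≥ (λ j<c → contradiction (trans (sym vj≡1) (zeros j j<c)) λ ())

isFib-∷ : ∀ {b} {v : Vec Bool n} → IsFibString p v → (b ≡ true → LeadingZeros p v) → IsFibString p (b ∷ v)
isFib-∷ {v = v} fib zeros zero    (suc j) b≡1 vj≡1 _ = s≤s (leadingZeros-≤ {v = v} (zeros b≡1) vj≡1)
isFib-∷ fib zeros (suc i) (suc j) vi≡1 vj≡1 (s≤s i<j) = s≤s (fib i j vi≡1 vj≡1 i<j)

isFib-tail : ∀ {b} {v : Vec Bool n} → IsFibString p (b ∷ v) → IsFibString p v
isFib-tail fib i j vi≡1 vj≡1 i<j = ≤-pred (fib (suc i) (suc j) vi≡1 vj≡1 (s≤s i<j))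

isFib-head : {v : Vec Bool n} → IsFibString p (true ∷ v) → LeadingZeros p v
isFib-head {v = v} fib j j<p with lookup v j in vj
... | false = refl
... | true  = contradiction (≤-pred (fib zero (suc j) refl vj (s≤s z≤n))) (<⇒≱ j<p)

isFib-antitone : {u v : Vec Bool n} → (∀ i → lookup u i ≡ true → lookup v i ≡ true) →
  IsFibString p v → IsFibString p u
isFib-antitone u⊆v fib i j ui≡1 uj≡1 = fib i j (u⊆v i ui≡1) (u⊆v j uj≡1)

lookup-[]≔false : (v : Vec Bool n) (k i : Fin n) → lookup (v [ k ]≔ false) i ≡ true → lookup v i ≡ true
lookup-[]≔false v k i vi≡1 with i ≟ᶠ k
... | yes refl = contradiction (trans (sym (lookup∘updateAt k v)) vi≡1) λ ()
... | no  i≢k  = trans (sym (lookup∘updateAt′ i k i≢k v)) vi≡1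

-- The automaton recognising Fibonacci p-strings from the left; its state c counts the zeros still owed after the last 1.
fibWithGap : ℕ → ℕ → Vec Bool n → Bool
fibWithGap p c       []          = true
fibWithGap p zero    (false ∷ v) = fibWithGap p zero v
fibWithGap p zero    (true ∷ v)  = fibWithGap p p v
fibWithGap p (suc c) (false ∷ v) = fibWithGap p c v
fibWithGap p (suc c) (true ∷ v)  = false

fibWithGap-sound : (v : Vec Bool n) → T (fibWithGap p c v) → IsFibString p v × LeadingZeros c v
fibWithGap-sound []                         _ = (λ ()) , (λ ())
fibWithGap-sound {c = zero}  (false ∷ v) h = let fib , _     = fibWithGap-sound v h in isFib-∷ fib (λ ()) , λ _ ()
fibWithGap-sound {c = zero}  (true ∷ v)  h = let fib , zeros = fibWithGap-sound v h in isFib-∷ fib (const zeros) , λ _ ()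
fibWithGap-sound {c = suc c} (false ∷ v) h = let fib , zeros = fibWithGap-sound v h in
  isFib-∷ fib (λ ()) , λ { zero _ → refl ; (suc i) (s≤s i<c) → zeros i i<c }

fibWithGap-complete : (v : Vec Bool n) → IsFibString p v → LeadingZeros c v → T (fibWithGap p c v)
fibWithGap-complete []                        fib zeros = tt
fibWithGap-complete {c = zero}  (false ∷ v) fib zeros = fibWithGap-complete v (isFib-tail fib) λ _ ()
fibWithGap-complete {c = zero}  (true ∷ v)  fib zeros = fibWithGap-complete v (isFib-tail fib) (isFib-head fib)
fibWithGap-complete {c = suc c} (false ∷ v) fib zeros = fibWithGap-complete v (isFib-tail fib) λ i i<c → zeros (suc i) (s≤s i<c)
fibWithGap-complete {c = suc c} (true ∷ v)  fib zeros = contradiction (zeros zero (s≤s z≤n)) λ ()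

does-isFibString? : (v : Vec Bool n) → does (isFibString? p v) ≡ fibWithGap p 0 v
does-isFibString? v = does-⇔ (mk⇔ (λ fib → fibWithGap-complete v fib λ _ ()) (proj₁ ∘ fibWithGap-sound v))
                             (isFibString? _ v) (T? _)

isFib-[]≔false : (v : Vec Bool n) (k : Fin n) → IsFibString p v → IsFibString p (v [ k ]≔ false)
isFib-[]≔false v k = isFib-antitone {u = v [ k ]≔ false} {v = v} (lookup-[]≔false v k)

countStrings-fibWithGap : 1 ≤ p → ∀ m c → countStrings m (fibWithGap p c) ≡ Fib p (suc (m + p ∸ c))
countStrings-fibWithGap {p} 1≤p zero zero = sym (trans (Fib-suc 1≤p) (cong₂ _+_ (Fib-one 1≤p ≤-refl) (cong (Fib p) (n∸n≡0 p))))
countStrings-fibWithGap {suc q} _ zero (suc c) = sym (Fib-one (s≤s z≤n) (s≤s (m∸n≤m q c)))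
countStrings-fibWithGap {p} 1≤p (suc m) zero = begin
  countStrings (suc m) (fibWithGap p 0)                             ≡⟨ countStrings-suc m _ ⟩
  countStrings m (fibWithGap p 0) + countStrings m (fibWithGap p p) ≡⟨ cong₂ _+_ (countStrings-fibWithGap 1≤p m 0) (countStrings-fibWithGap 1≤p m p) ⟩
  Fib p (suc (m + p)) + Fib p (suc (m + p ∸ p))                     ≡⟨ cong (λ r → Fib p (suc (m + p)) + Fib p (suc r)) (m+n∸n≡m m p) ⟩
  Fib p (suc (m + p)) + Fib p (suc m)                               ≡⟨ cong (λ r → Fib p (suc (m + p)) + Fib p r) (sym (m+n∸n≡m (suc m) p)) ⟩
  Fib p (suc (m + p)) + Fib p (suc (m + p) ∸ p)                     ≡⟨ sym (Fib-suc {suc (m + p)} {p} (s≤s z≤n)) ⟩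
  Fib p (suc (suc m + p))                                           ∎
  where open ≡-Reasoning
countStrings-fibWithGap {p} 1≤p (suc m) (suc c) = begin
  countStrings (suc m) (fibWithGap p (suc c))                    ≡⟨ countStrings-suc m _ ⟩
  countStrings m (fibWithGap p c) + countStrings m (const false) ≡⟨ cong₂ _+_ (countStrings-fibWithGap 1≤p m c) (countStrings-false m) ⟩
  Fib p (suc (m + p ∸ c)) + 0                                    ≡⟨ +-identityʳ _ ⟩
  Fib p (suc (m + p ∸ c))                                        ∎
  where open ≡-Reasoning

countStrings-one-at : 1 ≤ p → ∀ c (k : Fin n) →
  countStrings n (λ v → lookup v k ∧ fibWithGap p c v) ≡ Fib p (suc (toℕ k) ∸ c) * Fib p (suc (n ∸ suc (toℕ k)))
countStrings-one-at {p} {suc n} 1≤p zero zero = begin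
  countStrings (suc n) (λ v → lookup v zero ∧ fibWithGap p 0 v) ≡⟨ countStrings-suc n _ ⟩
  countStrings n (const false) + countStrings n (fibWithGap p p) ≡⟨ cong₂ _+_ (countStrings-false n) (countStrings-fibWithGap 1≤p n p) ⟩
  Fib p (suc (n + p ∸ p))                                        ≡⟨ cong (Fib p ∘ suc) (m+n∸n≡m n p) ⟩
  Fib p (suc n)                                                  ≡⟨ sym (*-identityˡ _) ⟩
  1 * Fib p (suc n)                                              ≡⟨ cong (_* Fib p (suc n)) (sym (Fib-one {1} {p} ≤-refl 1≤p)) ⟩
  Fib p 1 * Fib p (suc n)                                        ∎
  where open ≡-Reasoning
countStrings-one-at {p} {suc n} 1≤p (suc c) zero = begin
  countStrings (suc n) (λ v → lookup v zero ∧ fibWithGap p (suc c) v) ≡⟨ countStrings-suc n _ ⟩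
  countStrings n (const false) + countStrings n (const false)        ≡⟨ cong₂ _+_ (countStrings-false n) (countStrings-false n) ⟩
  Fib p 0 * Fib p (suc n)                                            ≡⟨ cong (λ r → Fib p r * Fib p (suc n)) (sym (0∸n≡0 c)) ⟩
  Fib p (0 ∸ c) * Fib p (suc n)                                      ∎
  where open ≡-Reasoning
countStrings-one-at {p} {suc n} 1≤p zero (suc k) = begin
  countStrings (suc n) (λ v → lookup v (suc k) ∧ fibWithGap p 0 v)
    ≡⟨ countStrings-suc n _ ⟩
  countStrings n (λ v → lookup v k ∧ fibWithGap p 0 v) + countStrings n (λ v → lookup v k ∧ fibWithGap p p v)
    ≡⟨ cong₂ _+_ (countStrings-one-at 1≤p 0 k) (countStrings-one-at 1≤p p k) ⟩
  Fib p (suc (toℕ k)) * rest + Fib p (suc (toℕ k) ∸ p) * rest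
    ≡⟨ sym (*-distribʳ-+ rest (Fib p (suc (toℕ k))) _) ⟩
  (Fib p (suc (toℕ k)) + Fib p (suc (toℕ k) ∸ p)) * rest
    ≡⟨ cong (_* rest) (sym (Fib-suc {suc (toℕ k)} {p} (s≤s z≤n))) ⟩
  Fib p (suc (suc (toℕ k))) * rest
    ∎
  where
  open ≡-Reasoning
  rest = Fib p (suc (n ∸ suc (toℕ k)))
countStrings-one-at {p} {suc n} 1≤p (suc c) (suc k) = begin
  countStrings (suc n) (λ v → lookup v (suc k) ∧ fibWithGap p (suc c) v)
    ≡⟨ countStrings-suc n _ ⟩
  countStrings n (λ v → lookup v k ∧ fibWithGap p c v) + countStrings n (λ v → lookup v k ∧ false)
    ≡⟨ cong₂ _+_ (countStrings-one-at 1≤p c k) (trans (countStrings-cong (λ v → ∧-zeroʳ (lookup v k))) (countStrings-false n)) ⟩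
  Fib p (suc (toℕ k) ∸ c) * Fib p (suc (n ∸ suc (toℕ k))) + 0
    ≡⟨ +-identityʳ _ ⟩
  Fib p (suc (toℕ k) ∸ c) * Fib p (suc (n ∸ suc (toℕ k)))
    ∎
  where open ≡-Reasoning

lookup-ext : {u v : Vec Bool n} → (∀ i → lookup u i ≡ lookup v i) → u ≡ v
lookup-ext {u = u} {v} u≗v = trans (sym (tabulate∘lookup u)) (trans (tabulate-cong u≗v) (tabulate∘lookup v))

differsExactlyAt⇔ : {u v : Vec Bool n} (k : Fin n) → lookup u k ≡ false →
  DiffersExactlyAt k u v ⇔ v ≡ u [ k ]≔ true
differsExactlyAt⇔ {u = u} {v} k uk≡0 = mk⇔ to from
  where
  to : DiffersExactlyAt k u v → v ≡ u [ k ]≔ true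
  to (uk≢vk , same) = lookup-ext pointwise
    where
    pointwise : ∀ i → lookup v i ≡ lookup (u [ k ]≔ true) i
    pointwise i with i ≟ᶠ k
    ... | yes refl = trans (trans (¬-not (uk≢vk ∘ sym)) (cong not uk≡0)) (sym (lookup∘updateAt k u))
    ... | no  i≢k  = trans (sym (same i i≢k)) (sym (lookup∘updateAt′ i k i≢k u))
  from : v ≡ u [ k ]≔ true → DiffersExactlyAt k u v
  from refl = (λ uk≡vk → contradiction (trans (sym uk≡0) (trans uk≡vk (lookup∘updateAt k u))) λ ())
            , (λ i i≢k → sym (lookup∘updateAt′ i k i≢k u))

IsLowerEnd : ℕ → Fin n → Vec Bool n → Set
IsLowerEnd p k u = lookup u k ≡ false × IsFibString p u × IsFibString p (u [ k ]≔ true)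

isLowerEnd? : ∀ p (k : Fin n) u → Dec (IsLowerEnd p k u)
isLowerEnd? p k u = (lookup u k ≟ᵇ false) ×-dec (isFibString? p u ×-dec isFibString? p (u [ k ]≔ true))

isEdgeInDir⇔ : (k : Fin n) (u v : Vec Bool n) → IsEdgeInDir p k (u , v) ⇔ (IsLowerEnd p k u × v ≡ u [ k ]≔ true)
isEdgeInDir⇔ {p = p} k u v = mk⇔ to from
  where
  to : IsEdgeInDir p k (u , v) → IsLowerEnd p k u × v ≡ u [ k ]≔ true
  to (fibu , fibv , differs , uk≡0) = (uk≡0 , fibu , subst (IsFibString p) v≡ fibv) , v≡
    where v≡ = Equivalence.to (differsExactlyAt⇔ {u = u} {v} k uk≡0) differs
  from : IsLowerEnd p k u × v ≡ u [ k ]≔ true → IsEdgeInDir p k (u , v)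
  from ((uk≡0 , fibu , fibv) , refl) = fibu , fibv , Equivalence.from (differsExactlyAt⇔ {u = u} k uk≡0) refl , uk≡0

countStrings-edgesFrom : (k : Fin n) (u : Vec Bool n) →
  countStrings n (λ v → does (isEdgeInDir? p k (u , v))) ≡ indicator (does (isLowerEnd? p k u))
countStrings-edgesFrom {p = p} k u = trans
  (countStrings-cong λ v → does-⇔ (isEdgeInDir⇔ k u v) (isEdgeInDir? p k (u , v)) (isLowerEnd? p k u ×-dec (v ≟ᵛ (u [ k ]≔ true))))
  (countStrings-∧-≟ (does (isLowerEnd? p k u)) (u [ k ]≔ true))

countStrings-flip : (k : Fin n) (R : Vec Bool n → Vec Bool n → Bool) →
  countStrings n (λ u → does (lookup u k ≟ᵇ false) ∧ R u (u [ k ]≔ true)) ≡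
  countStrings n (λ v → does (lookup v k ≟ᵇ true) ∧ R (v [ k ]≔ false) v)
countStrings-flip {suc n} zero R = begin
  countStrings (suc n) (λ u → does (lookup u zero ≟ᵇ false) ∧ R u (u [ zero ]≔ true)) ≡⟨ countStrings-suc n _ ⟩
  countStrings n (λ w → R (false ∷ w) (true ∷ w)) + countStrings n (const false) ≡⟨ +-comm _ (countStrings n (const false)) ⟩
  countStrings n (const false) + countStrings n (λ w → R (false ∷ w) (true ∷ w)) ≡⟨ sym (countStrings-suc n _) ⟩
  countStrings (suc n) (λ v → does (lookup v zero ≟ᵇ true) ∧ R (v [ zero ]≔ false) v) ∎
  where open ≡-Reasoning
countStrings-flip {suc n} (suc k) R = begin
  countStrings (suc n) (λ u → does (lookup u (suc k) ≟ᵇ false) ∧ R u (u [ suc k ]≔ true))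
    ≡⟨ countStrings-suc n _ ⟩
  countStrings n (λ u → does (lookup u k ≟ᵇ false) ∧ R (false ∷ u) (false ∷ u [ k ]≔ true)) +
  countStrings n (λ u → does (lookup u k ≟ᵇ false) ∧ R (true ∷ u) (true ∷ u [ k ]≔ true))
    ≡⟨ cong₂ _+_ (countStrings-flip k (λ u w → R (false ∷ u) (false ∷ w))) (countStrings-flip k (λ u w → R (true ∷ u) (true ∷ w))) ⟩
  countStrings n (λ v → does (lookup v k ≟ᵇ true) ∧ R (false ∷ v [ k ]≔ false) (false ∷ v)) +
  countStrings n (λ v → does (lookup v k ≟ᵇ true) ∧ R (true ∷ v [ k ]≔ false) (true ∷ v))
    ≡⟨ sym (countStrings-suc n _) ⟩
  countStrings (suc n) (λ v → does (lookup v (suc k) ≟ᵇ true) ∧ R (v [ suc k ]≔ false) v)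
    ∎
  where open ≡-Reasoning

edgeCount≡upperEnds : (k : Fin n) → EdgeCount p k ≡ countStrings n (λ v → lookup v k ∧ fibWithGap p 0 v)
edgeCount≡upperEnds {n} {p} k = begin
  EdgeCount p k
    ≡⟨ length-filter≡count (isEdgeInDir? p k) (cartesianProduct strings strings) ⟩
  count (does ∘ isEdgeInDir? p k) (cartesianProduct strings strings)
    ≡⟨ count-cartesianProduct _ strings strings ⟩
  sum (map (λ u → countStrings n (λ v → does (isEdgeInDir? p k (u , v)))) strings)
    ≡⟨ cong sum (map-cong (countStrings-edgesFrom k) strings) ⟩
  countStrings n (does ∘ isLowerEnd? p k)
    ≡⟨ countStrings-flip k (λ u w → does (isFibString? p u) ∧ does (isFibString? p w)) ⟩
  countStrings n (λ v → does (lookup v k ≟ᵇ true) ∧ (does (isFibString? p (v [ k ]≔ false)) ∧ does (isFibString? p v)))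
    ≡⟨ countStrings-cong upperEnd ⟩
  countStrings n (λ v → lookup v k ∧ fibWithGap p 0 v)
    ∎
  where
  open ≡-Reasoning
  strings = allStrings n

  does-≟-true : ∀ b → does (b ≟ᵇ true) ≡ b
  does-≟-true false = refl
  does-≟-true true  = refl

  upperEnd : ∀ v → does (lookup v k ≟ᵇ true) ∧ (does (isFibString? p (v [ k ]≔ false)) ∧ does (isFibString? p v))
                 ≡ lookup v k ∧ fibWithGap p 0 v
  upperEnd v = cong₂ _∧_ (does-≟-true (lookup v k)) (trans
    (does-⇔ (mk⇔ proj₂ λ fib → isFib-[]≔false v k fib , fib) (isFibString? p (v [ k ]≔ false) ×-dec isFibString? p v) (isFibString? p v))
    (does-isFibString? v))

proposition4p6 : (p n : ℕ) → 1 ≤ p → 1 ≤ n → (k : Fin n) →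
    EdgeCount p k ≡ Fib p (suc (toℕ k)) * Fib p (n ∸ suc (toℕ k) + 1)
proposition4p6 p n 1≤p _ k = begin
  EdgeCount p k                                                ≡⟨ edgeCount≡upperEnds k ⟩
  countStrings n (λ v → lookup v k ∧ fibWithGap p 0 v)         ≡⟨ countStrings-one-at 1≤p 0 k ⟩
  Fib p (suc (toℕ k)) * Fib p (suc (n ∸ suc (toℕ k)))          ≡⟨ cong (λ r → Fib p (suc (toℕ k)) * Fib p r) (+-comm 1 _) ⟩
  Fib p (suc (toℕ k)) * Fib p (n ∸ suc (toℕ k) + 1)            ∎
  where open ≡-Reasoning
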